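{- Let $n$ be an even positive integer, let $M$ be a partial matching of $K_n$ covering $2d$ vertices, and let $a$ be a vertex not covered by $M$. Then $x_M\equiv_{(\mathcal P_n,d+1)}\sum_{u}x_{M\cup\{\{a,u\}\}}$, where the sum is over all vertices $u$ of $K_n$ not covered by $M$ and different from $a$.
   Context: Variables $x_{uv}$ are indexed by edges of $K_n$; for a partial matching $M$, $x_M=\prod_{e\in M}x_e$. $\mathcal P_n=\{x_{uv}x_{uw}: u,v,w\text{ distinct}\}\cup\{\sum_{u\ne v}x_{uv}-1: v\in[n]\}\cup\{x_{uv}^2-x_{uv}\}$. $F\equiv_{(\mathcal P,d)}G$ means there exist polynomials $q(p)$ with $F+\sum_p q(p)p=G$ and $\max_p\deg(q(p)p)\le d$. -}

module Defs where

open import Level using (_⊔_)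
open import Algebra.Bundles using (CommutativeRing)
open import Data.Nat as ℕ using (ℕ; zero; suc; _<_; _<ᵇ_)
open import Data.Fin as Fin using (Fin; toℕ)
open import Data.Fin.Properties as FinP using ()
open import Data.Bool using (Bool; true; false; if_then_else_; _∧_; _∨_)
open import Data.Product using (_×_; _,_; Σ; ∃; ∃-syntax)
open import Data.List as List using (List; []; _∷_; _++_; map; concatMap; foldr; filter; allFin)
open import Data.List.Relation.Unary.All using (All)
open import Data.Vec as Vec using (tabulate)
open import Relation.Nullary using (¬_; Dec; yes; no)
open import Relation.Nullary.Decidable using (⌊_⌋; ¬?; _×-dec_; _→-dec_)
open import Relation.Binary.PropositionalEquality using (_≡_; _≢_)

-- A monomial is an exponent table  m : Fin n → Fin n → ℕ ;
-- only entries with toℕ u < toℕ v are meaningful: the exponent of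
-- x_{uv} (= x_{vu}) is  m u v  for u < v.  Entries with u ≥ v are ignored
-- by every notion below (equality of monomials, degree).

Mono : ℕ → Set
Mono n = Fin n → Fin n → ℕ

_≈M_ : ∀ {n} → Mono n → Mono n → Set
_≈M_ {n} m m' = ∀ (u v : Fin n) → toℕ u < toℕ v → m u v ≡ m' u v

_≈M?_ : ∀ {n} (m m' : Mono n) → Dec (m ≈M m')
m ≈M? m' = FinP.all? λ u → FinP.all? λ v →
  (toℕ u ℕ.<? toℕ v) →-dec (m u v ℕ.≟ m' u v)

oneM : ∀ {n} → Mono n
oneM _ _ = 0

_⊗M_ : ∀ {n} → Mono n → Mono n → Mono n
(m ⊗M m') u v = m u v ℕ.+ m' u v

singleM : ∀ {n} → Fin n → Fin n → Mono n
singleM u v a b =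
  if (⌊ a FinP.≟ u ⌋ ∧ ⌊ b FinP.≟ v ⌋) ∨ (⌊ a FinP.≟ v ⌋ ∧ ⌊ b FinP.≟ u ⌋)
  then 1 else 0

totalDeg : ∀ {n} → Mono n → ℕ
totalDeg {n} m = Vec.sum (tabulate λ a → Vec.sum (tabulate λ b →
  if toℕ a <ᵇ toℕ b then m a b else 0))

module Poly {c ℓ} (R : CommutativeRing c ℓ) where
  open CommutativeRing R renaming (Carrier to A)

  -- a polynomial is a finite formal sum of terms  coeff · monomial
  P : ℕ → Set c
  P n = List (A × Mono n)

  coeff : ∀ {n} → P n → Mono n → A
  coeff p m = foldr (λ { (a , m') acc → if ⌊ m' ≈M? m ⌋ then a + acc else acc }) 0# p

  _≈P_ : ∀ {n} → P n → P n → Set ℓ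
  p ≈P q = ∀ m → coeff p m ≈ coeff q m

  _+P_ : ∀ {n} → P n → P n → P n
  _+P_ = _++_

  -P_ : ∀ {n} → P n → P n
  -P p = map (λ { (a , m) → (- a , m) }) p

  _*P_ : ∀ {n} → P n → P n → P n
  p *P q = concatMap (λ { (a , m) → map (λ { (b , m') → (a * b , m ⊗M m') }) q }) p

  constP : ∀ {n} → A → P n
  constP a = (a , oneM) ∷ []

  oneP : ∀ {n} → P n
  oneP = constP 1#

  sumP : ∀ {n} → List (P n) → P n
  sumP = foldr _+P_ []

  prodP : ∀ {n} → List (P n) → P n
  prodP = foldr _*P_ oneP

  x : ∀ {n} → Fin n → Fin n → P n
  x u v = (1# , singleM u v) ∷ []

  DegLE : ∀ {n} → ℕ → P n → Set ℓ
  DegLE d f = ∀ m → d < totalDeg m → coeff f m ≈ 0#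

  -- The axiom set 𝒫_n, indexed by a type of generators.
  data Gen (n : ℕ) : Set where
    prodAx : (u v w : Fin n) → u ≢ v → u ≢ w → v ≢ w → Gen n
    sumAx  : (v : Fin n) → Gen n
    boolAx : (u v : Fin n) → u ≢ v → Gen n

  genP : ∀ {n} → Gen n → P n
  genP (prodAx u v w _ _ _) = x u v *P x u w
  genP {n} (sumAx v) =
    sumP (map (λ u → x u v) (filter (λ u → ¬? (u FinP.≟ v)) (allFin n))) +P (-P oneP)
  genP (boolAx u v _) = (x u v *P x u v) +P (-P x u v)

  -- F ≡_{(𝒫_n, d)} G : there are polynomials q(p) (finitely many nonzero,
  -- given as a list of pairs (q , p)) with F + Σ q(p) p = G and
  -- deg(q(p) p) ≤ d for each of them.
  Derivable : (n d : ℕ) → P n → P n → Set (c ⊔ ℓ)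
  Derivable n d F G =
    Σ (List (P n × Gen n)) λ L →
      All (λ { (q , g) → DegLE d (q *P genP g) }) L
      × ((F +P sumP (map (λ { (q , g) → q *P genP g }) L)) ≈P G)

endpoints : ∀ {n} → List (Fin n × Fin n) → List (Fin n)
endpoints = concatMap (λ { (u , v) → u ∷ v ∷ [] })

module _ {n : ℕ} where
  open import Data.List.Membership.DecPropositional (FinP._≟_ {n}) public
    using (_∈_; _∉_; _∈?_)

freeOthers : ∀ {n} → List (Fin n × Fin n) → Fin n → List (Fin n)
freeOthers {n} M a =
  filter (λ u → ¬? (u ∈? endpoints M) ×-dec ¬? (u FinP.≟ a)) (allFin n)

module MatchPoly {c ℓ} (R : CommutativeRing c ℓ) where
  open Poly R
  xM : ∀ {n} → List (Fin n × Fin n) → P n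
  xM M = prodP (map (λ { (u , v) → x u v }) M)

module Submission where

-- Let E be the set of vertices covered by M and, for u ∈ E, let w be
-- the partner of u and M ∖ uw the matching without that edge.  The derivation
-- uses x_M times the sum axiom at a and, for every u ∈ E, the multiple
-- −x_{M ∖ uw} of the product axiom x_{uw} x_{ua} (u, w, a are distinct):
--
--   x_M + x_M (Σ_{u ≠ a} x_{ua} − 1) − Σ_{u ∈ E} x_{M ∖ uw} x_{uw} x_{ua}
--     = Σ_{u ≠ a} x_M x_{ua} − Σ_{u ∈ E} x_M x_{ua}
--     = Σ_{u ∉ E, u ≠ a} x_{M ∪ {au}},
--
-- since x_{M ∖ uw} x_{uw} = x_M and a ∉ E; every product has degree |M| + 1.

open import Defs
open import Algebra.Bundles using (CommutativeRing)
open import Data.Nat using (ℕ; suc; _<_)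
open import Data.Nat.Divisibility using (_∣_)
open import Data.Fin using (Fin)
open import Data.Product using (_×_; _,_)
open import Data.List using (List; length; map; _∷_)
open import Data.List.Relation.Unary.Unique.Propositional using (Unique)
open import Relation.Binary.PropositionalEquality using (_≡_)

import Data.Nat as ℕ
open import Data.Nat using (zero; _≤_; _<ᵇ_; z≤n)
open import Data.Nat.Properties as ℕP using (+-0-commutativeMonoid)
open import Data.Fin as Fin using (toℕ; punchIn)
open import Data.Fin.Properties using (_≟_; punchInᵢ≢i)
open import Data.Bool using (true; false; if_then_else_; _∧_; _∨_; T)
open import Data.Bool.Properties using (∨-comm)
open import Data.Unit using (tt)
open import Data.Empty using (⊥-elim)
open import Data.Sum using (_⊎_; inj₁; inj₂; [_,_])
open import Data.Product using (proj₁; proj₂)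
open import Data.List using ([]; _++_; filter; allFin; concatMap; foldr)
open import Data.List.Relation.Unary.Any using (here; there)
open import Data.List.Relation.Unary.All as All using (All; []; _∷_)
open import Data.List.Relation.Unary.All.Properties using (++⁺; concat⁺; map⁺)
open import Data.List.Relation.Unary.AllPairs using (_∷_)
open import Data.Vec.Functional using (removeAt)
import Data.Vec as Vec
open import Function using (_∘_)
open import Relation.Nullary using (Dec; yes; no; does)
open import Relation.Nullary.Decidable using (⌊_⌋; ¬?; _×-dec_)
open import Relation.Binary.PropositionalEquality
  using (_≢_; refl; sym; trans; cong; cong₂; subst; subst₂; module ≡-Reasoning)
import Algebra.Properties.CommutativeSemigroup as CommSemigroupProperties
open import Algebra.Properties.CommutativeMonoid.Sum +-0-commutativeMonoid
  using (sum; sum-cong-≗; sum-replicate-zero; sum-remove; ∑-distrib-+)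

vecSum-tabulate : ∀ {n} (f : Fin n → ℕ) → Vec.sum (Vec.tabulate f) ≡ sum f
vecSum-tabulate {zero} f = refl
vecSum-tabulate {suc n} f = cong (f Fin.zero ℕ.+_) (vecSum-tabulate (f ∘ Fin.suc))

sum-zero : ∀ {n} {f : Fin n → ℕ} → (∀ i → f i ≡ 0) → sum f ≡ 0
sum-zero {n} f≡0 = trans (sum-cong-≗ f≡0) (sum-replicate-zero n)

sum-at : ∀ {n} (f : Fin n → ℕ) (p : Fin n) → (∀ i → i ≢ p → f i ≡ 0) → sum f ≡ f p
sum-at {suc n} f p off = begin
  sum f                       ≡⟨ sum-remove {i = p} f ⟩
  f p ℕ.+ sum (removeAt f p)  ≡⟨ cong (f p ℕ.+_) (sum-zero λ j → off (punchIn p j) (punchInᵢ≢i p j)) ⟩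
  f p ℕ.+ 0                   ≡⟨ ℕP.+-identityʳ (f p) ⟩
  f p                         ∎
  where open ≡-Reasoning

sum²-at : ∀ {n} (F : Fin n → Fin n → ℕ) (p q : Fin n) →
  (∀ a b → a ≢ p ⊎ b ≢ q → F a b ≡ 0) → sum (λ a → sum (F a)) ≡ F p q
sum²-at F p q off =
  trans (sum-at _ p λ a a≢p → sum-zero λ b → off a b (inj₁ a≢p))
        (sum-at (F p) q λ b b≢q → off p b (inj₂ b≢q))

counted : ∀ {n} → Mono n → Fin n → Fin n → ℕ
counted m a b = if toℕ a <ᵇ toℕ b then m a b else 0

totalDeg-sum : ∀ {n} (m : Mono n) → totalDeg m ≡ sum (λ a → sum (counted m a))
totalDeg-sum m = trans (vecSum-tabulate (λ a → Vec.sum (Vec.tabulate (counted m a))))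
                       (sum-cong-≗ λ a → vecSum-tabulate (counted m a))

totalDeg-cong : ∀ {n} {m m' : Mono n} → (∀ a b → counted m a b ≡ counted m' a b) →
  totalDeg m ≡ totalDeg m'
totalDeg-cong {m = m} {m'} e = begin
  totalDeg m                        ≡⟨ totalDeg-sum m ⟩
  sum (λ a → sum (counted m a))     ≡⟨ sum-cong-≗ (λ a → sum-cong-≗ (e a)) ⟩
  sum (λ a → sum (counted m' a))    ≡⟨ totalDeg-sum m' ⟨
  totalDeg m'                       ∎
  where open ≡-Reasoning

counted-zero : ∀ {n} (m : Mono n) a b → m a b ≡ 0 → counted m a b ≡ 0
counted-zero m a b m≡0 with toℕ a <ᵇ toℕ b
... | true  = m≡0
... | false = refl

counted-order : ∀ {n} (m : Mono n) a b → (toℕ a <ᵇ toℕ b) ≡ false → counted m a b ≡ 0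
counted-order m a b a≮b rewrite a≮b = refl

counted-≤ : ∀ {n} (m : Mono n) a b → counted m a b ≤ m a b
counted-≤ m a b with toℕ a <ᵇ toℕ b
... | true  = ℕP.≤-refl
... | false = z≤n

deg-≈M : ∀ {n} {m m' : Mono n} → m ≈M m' → totalDeg m ≡ totalDeg m'
deg-≈M {m = m} {m'} e = totalDeg-cong counted-eq
  where
  counted-eq : ∀ a b → counted m a b ≡ counted m' a b
  counted-eq a b with toℕ a <ᵇ toℕ b in a<b
  ... | true  = e a b (ℕP.<ᵇ⇒< (toℕ a) (toℕ b) (subst T (sym a<b) tt))
  ... | false = refl

deg-≗ : ∀ {n} {m m' : Mono n} → (∀ a b → m a b ≡ m' a b) → totalDeg m ≡ totalDeg m'
deg-≗ e = deg-≈M (λ a b _ → e a b)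

deg-⊗ : ∀ {n} (m m' : Mono n) → totalDeg (m ⊗M m') ≡ totalDeg m ℕ.+ totalDeg m'
deg-⊗ m m' = begin
  totalDeg (m ⊗M m')
    ≡⟨ totalDeg-sum (m ⊗M m') ⟩
  sum (λ a → sum (counted (m ⊗M m') a))
    ≡⟨ sum-cong-≗ row ⟩
  sum (λ a → sum (counted m a) ℕ.+ sum (counted m' a))
    ≡⟨ ∑-distrib-+ (λ a → sum (counted m a)) (λ a → sum (counted m' a)) ⟩
  sum (λ a → sum (counted m a)) ℕ.+ sum (λ a → sum (counted m' a))
    ≡⟨ cong₂ ℕ._+_ (totalDeg-sum m) (totalDeg-sum m') ⟨
  totalDeg m ℕ.+ totalDeg m'
    ∎
  where
  open ≡-Reasoning
  entry : ∀ a b → counted (m ⊗M m') a b ≡ counted m a b ℕ.+ counted m' a b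
  entry a b with toℕ a <ᵇ toℕ b
  ... | true  = refl
  ... | false = refl
  row : ∀ a → sum (counted (m ⊗M m') a) ≡ sum (counted m a) ℕ.+ sum (counted m' a)
  row a = trans (sum-cong-≗ (entry a)) (∑-distrib-+ (counted m a) (counted m' a))

deg-oneM : ∀ {n} → totalDeg (oneM {n}) ≡ 0
deg-oneM {n} = trans (totalDeg-sum (oneM {n}))
                     (sum-zero {n} λ a → sum-zero {n} λ b → counted-zero oneM a b refl)

singleM-sym : ∀ {n} (u v : Fin n) a b → singleM u v a b ≡ singleM v u a b
singleM-sym u v a b =
  cong (λ t → if t then 1 else 0) (∨-comm (⌊ a ≟ u ⌋ ∧ ⌊ b ≟ v ⌋) (⌊ a ≟ v ⌋ ∧ ⌊ b ≟ u ⌋))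

singleM-≤1 : ∀ {n} (u v : Fin n) a b → singleM u v a b ≤ 1
singleM-≤1 u v a b with (⌊ a ≟ u ⌋ ∧ ⌊ b ≟ v ⌋) ∨ (⌊ a ≟ v ⌋ ∧ ⌊ b ≟ u ⌋)
... | true  = ℕP.≤-refl
... | false = z≤n

position-test-false : ∀ {n} {a b u v : Fin n} → a ≢ u ⊎ b ≢ v → (⌊ a ≟ u ⌋ ∧ ⌊ b ≟ v ⌋) ≡ false
position-test-false {a = a} {b} {u} {v} off with a ≟ u | b ≟ v
... | yes a≡u | yes b≡v = ⊥-elim ([ (λ a≢u → a≢u a≡u) , (λ b≢v → b≢v b≡v) ] off)
... | yes _   | no _    = refl
... | no _    | _       = refl

singleM-off : ∀ {n} (u v a b : Fin n) → a ≢ u ⊎ b ≢ v → a ≢ v ⊎ b ≢ u → singleM u v a b ≡ 0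
singleM-off u v a b off off' =
  cong (λ t → if t then 1 else 0) (cong₂ _∨_ (position-test-false off) (position-test-false off'))

deg-singleM-at : ∀ {n} (u v : Fin n) → (toℕ v <ᵇ toℕ u) ≡ false → totalDeg (singleM u v) ≤ 1
deg-singleM-at u v v≮u = begin
  totalDeg (singleM u v)                     ≡⟨ totalDeg-sum (singleM u v) ⟩
  sum (λ a → sum (counted (singleM u v) a))  ≡⟨ sum²-at _ u v off ⟩
  counted (singleM u v) u v                  ≤⟨ counted-≤ (singleM u v) u v ⟩
  singleM u v u v                            ≤⟨ singleM-≤1 u v u v ⟩
  1                                          ∎
  where
  open ℕP.≤-Reasoning
  off : ∀ a b → a ≢ u ⊎ b ≢ v → counted (singleM u v) a b ≡ 0
  -- at (v , u) the order test fails; elsewhere singleM u v is 0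
  off a b off₁ = by-cases (a ≟ v) (b ≟ u)
    where
    by-cases : Dec (a ≡ v) → Dec (b ≡ u) → counted (singleM u v) a b ≡ 0
    by-cases (yes a≡v) (yes b≡u) = counted-order (singleM u v) a b
      (subst₂ (λ x y → (toℕ x <ᵇ toℕ y) ≡ false) (sym a≡v) (sym b≡u) v≮u)
    by-cases (no a≢v) _ = counted-zero (singleM u v) a b (singleM-off u v a b off₁ (inj₁ a≢v))
    by-cases _ (no b≢u) = counted-zero (singleM u v) a b (singleM-off u v a b off₁ (inj₂ b≢u))

deg-singleM : ∀ {n} (u v : Fin n) → totalDeg (singleM u v) ≤ 1
deg-singleM u v with toℕ v <ᵇ toℕ u in v<u
... | false = deg-singleM-at u v v<u
... | true  = subst (_≤ 1) (deg-≗ (singleM-sym v u)) (deg-singleM-at v u u≮v)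
  where
  u≮v : (toℕ u <ᵇ toℕ v) ≡ false
  u≮v with toℕ u <ᵇ toℕ v in u<v
  ... | false = refl
  ... | true  = ⊥-elim (ℕP.<-asym (ℕP.<ᵇ⇒< (toℕ u) (toℕ v) (subst T (sym u<v) tt))
                                   (ℕP.<ᵇ⇒< (toℕ v) (toℕ u) (subst T (sym v<u) tt)))

matchingMono : ∀ {n} → List (Fin n × Fin n) → Mono n
matchingMono []            = oneM
matchingMono ((p , q) ∷ M) = singleM p q ⊗M matchingMono M

deg-matchingMono : ∀ {n} (M : List (Fin n × Fin n)) → totalDeg (matchingMono M) ≤ length M
deg-matchingMono {n} [] = ℕP.≤-reflexive (deg-oneM {n})
deg-matchingMono ((p , q) ∷ M) = begin
  totalDeg (singleM p q ⊗M matchingMono M)             ≡⟨ deg-⊗ (singleM p q) (matchingMono M) ⟩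
  totalDeg (singleM p q) ℕ.+ totalDeg (matchingMono M) ≤⟨ ℕP.+-mono-≤ (deg-singleM p q) (deg-matchingMono M) ⟩
  1 ℕ.+ length M                                       ∎
  where open ℕP.≤-Reasoning

cutAt : ∀ {n} (M : List (Fin n × Fin n)) {u : Fin n} → u ∈ endpoints M →
  Fin n × List (Fin n × Fin n)
cutAt ((p , q) ∷ M) (here _)             = q , M
cutAt ((p , q) ∷ M) (there (here _))     = p , M
cutAt ((p , q) ∷ M) (there (there u∈M))  =
  proj₁ (cutAt M u∈M) , (p , q) ∷ proj₂ (cutAt M u∈M)

partner : ∀ {n} (M : List (Fin n × Fin n)) {u : Fin n} → u ∈ endpoints M → Fin n
partner M u∈M = proj₁ (cutAt M u∈M)

remainder : ∀ {n} (M : List (Fin n × Fin n)) {u : Fin n} → u ∈ endpoints M → List (Fin n × Fin n)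
remainder M u∈M = proj₂ (cutAt M u∈M)

remainder-length : ∀ {n} (M : List (Fin n × Fin n)) {u : Fin n} (u∈M : u ∈ endpoints M) →
  length M ≡ suc (length (remainder M u∈M))
remainder-length ((p , q) ∷ M) (here _)            = refl
remainder-length ((p , q) ∷ M) (there (here _))    = refl
remainder-length ((p , q) ∷ M) (there (there u∈M)) = cong suc (remainder-length M u∈M)

partner-∈ : ∀ {n} (M : List (Fin n × Fin n)) {u : Fin n} (u∈M : u ∈ endpoints M) →
  partner M u∈M ∈ endpoints M
partner-∈ ((p , q) ∷ M) (here _)            = there (here refl)
partner-∈ ((p , q) ∷ M) (there (here _))    = here refl
partner-∈ ((p , q) ∷ M) (there (there u∈M)) = there (there (partner-∈ M u∈M))

partner-≢ : ∀ {n} (M : List (Fin n × Fin n)) {u : Fin n} (u∈M : u ∈ endpoints M) →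
  Unique (endpoints M) → u ≢ partner M u∈M
partner-≢ ((p , q) ∷ M) (here refl)         ((p≢q ∷ _) ∷ _) = p≢q
partner-≢ ((p , q) ∷ M) (there (here refl)) ((p≢q ∷ _) ∷ _) = p≢q ∘ sym
partner-≢ ((p , q) ∷ M) (there (there u∈M)) (_ ∷ _ ∷ uniq)  = partner-≢ M u∈M uniq

matchingMono-cut : ∀ {n} (M : List (Fin n × Fin n)) {u : Fin n} (u∈M : u ∈ endpoints M) a b →
  matchingMono M a b ≡ singleM u (partner M u∈M) a b ℕ.+ matchingMono (remainder M u∈M) a b
matchingMono-cut ((p , q) ∷ M) (here refl)         a b = refl
matchingMono-cut ((p , q) ∷ M) (there (here refl)) a b = cong (ℕ._+ matchingMono M a b) (singleM-sym p q a b)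
matchingMono-cut ((p , q) ∷ M) {u} (there (there u∈M)) a b = begin
  singleM p q a b ℕ.+ matchingMono M a b
    ≡⟨ cong (singleM p q a b ℕ.+_) (matchingMono-cut M u∈M a b) ⟩
  singleM p q a b ℕ.+ (singleM u w a b ℕ.+ matchingMono M' a b)
    ≡⟨ CommSemigroupProperties.x∙yz≈y∙xz ℕP.+-commutativeSemigroup
         (singleM p q a b) (singleM u w a b) (matchingMono M' a b) ⟩
  singleM u w a b ℕ.+ (singleM p q a b ℕ.+ matchingMono M' a b) ∎
  where
  open ≡-Reasoning
  w  = partner M u∈M
  M' = remainder M u∈M

matchingMono-reassemble : ∀ {n} (M : List (Fin n × Fin n)) {u : Fin n} (u∈M : u ∈ endpoints M)
  (y : Mono n) a b →
  (matchingMono (remainder M u∈M) ⊗M (singleM u (partner M u∈M) ⊗M y)) a b ≡ (matchingMono M ⊗M y) a b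
matchingMono-reassemble M {u} u∈M y a b = begin
  M' a b ℕ.+ (uw a b ℕ.+ y a b)   ≡⟨ ℕP.+-assoc (M' a b) (uw a b) (y a b) ⟨
  (M' a b ℕ.+ uw a b) ℕ.+ y a b   ≡⟨ cong (ℕ._+ y a b) (ℕP.+-comm (M' a b) (uw a b)) ⟩
  (uw a b ℕ.+ M' a b) ℕ.+ y a b   ≡⟨ cong (ℕ._+ y a b) (matchingMono-cut M u∈M a b) ⟨
  matchingMono M a b ℕ.+ y a b    ∎
  where
  open ≡-Reasoning
  M' = matchingMono (remainder M u∈M)
  uw = singleM u (partner M u∈M)

-- For a fixed monomial m0, `coeff _ m0`
-- is additive on concatenation, so identities between coefficients reduce to
-- sums over lists of the contributions of single terms.
module Coefficients {c ℓ} (R : CommutativeRing c ℓ) where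
  open Poly R
  open MatchPoly R
  open CommutativeRing R
    using (_≈_; _+_; _*_; -_; 0#; 1#; setoid; +-cong; +-congˡ; +-congʳ; +-assoc; +-comm;
           +-identityˡ; +-identityʳ; *-identityˡ; ring; +-commutativeSemigroup)
    renaming (Carrier to A; refl to ≈-refl; sym to ≈-sym; trans to ≈-trans)
  open import Algebra.Properties.Ring ring using (-0#≈0#)
  open import Relation.Binary.Reasoning.Setoid setoid

  cancel-inside : ∀ {x s y t} → x + y ≈ 0# → x + ((s + y) + t) ≈ s + t
  cancel-inside {x} {s} {y} {t} x+y≈0 = begin
    x + ((s + y) + t)  ≈⟨ +-congˡ (+-congʳ (+-comm s y)) ⟩
    x + ((y + s) + t)  ≈⟨ +-congˡ (+-assoc y s t) ⟩
    x + (y + (s + t))  ≈⟨ +-assoc x y (s + t) ⟨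
    (x + y) + (s + t)  ≈⟨ +-congʳ x+y≈0 ⟩
    0# + (s + t)       ≈⟨ +-identityˡ (s + t) ⟩
    s + t              ∎

  sumOver : ∀ {x} {X : Set x} → List X → (X → A) → A
  sumOver xs f = foldr (λ y acc → f y + acc) 0# xs

  sumOver-cong : ∀ {x} {X : Set x} (xs : List X) {f g : X → A} → (∀ y → f y ≈ g y) →
    sumOver xs f ≈ sumOver xs g
  sumOver-cong []       f≈g = ≈-refl
  sumOver-cong (y ∷ xs) f≈g = +-cong (f≈g y) (sumOver-cong xs f≈g)

  sumOver-++ : ∀ {x} {X : Set x} (xs ys : List X) (f : X → A) →
    sumOver (xs ++ ys) f ≈ sumOver xs f + sumOver ys f
  sumOver-++ []       ys f = ≈-sym (+-identityˡ _)
  sumOver-++ (y ∷ xs) ys f = ≈-trans (+-congˡ (sumOver-++ xs ys f)) (≈-sym (+-assoc _ _ _))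

  sumOver-+ : ∀ {x} {X : Set x} (xs : List X) (f g : X → A) →
    sumOver xs (λ y → f y + g y) ≈ sumOver xs f + sumOver xs g
  sumOver-+ []       f g = ≈-sym (+-identityˡ _)
  sumOver-+ (y ∷ xs) f g = begin
    (f y + g y) + sumOver xs (λ z → f z + g z) ≈⟨ +-congˡ (sumOver-+ xs f g) ⟩
    (f y + g y) + (sumOver xs f + sumOver xs g) ≈⟨ +-assoc _ _ _ ⟩
    f y + (g y + (sumOver xs f + sumOver xs g)) ≈⟨ +-congˡ (x∙yz≈y∙xz _ _ _) ⟩
    f y + (sumOver xs f + (g y + sumOver xs g)) ≈⟨ +-assoc _ _ _ ⟨
    (f y + sumOver xs f) + (g y + sumOver xs g) ∎
    where open CommSemigroupProperties +-commutativeSemigroup using (x∙yz≈y∙xz)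

  sumOver-filter : ∀ {x p} {X : Set x} {Q : X → Set p} (Q? : ∀ y → Dec (Q y))
    (xs : List X) (f : X → A) →
    sumOver (filter Q? xs) f ≈ sumOver xs (λ y → if does (Q? y) then f y else 0#)
  sumOver-filter Q? []       f = ≈-refl
  sumOver-filter Q? (y ∷ xs) f with does (Q? y)
  ... | true  = +-congˡ (sumOver-filter Q? xs f)
  ... | false = ≈-trans (sumOver-filter Q? xs f) (≈-sym (+-identityˡ _))

  sumOver-concatMap : ∀ {x y} {X : Set x} {Y : Set y} (e : X → List Y) (xs : List X) (f : Y → A) →
    sumOver (concatMap e xs) f ≈ sumOver xs (λ u → sumOver (e u) f)
  sumOver-concatMap e []       f = ≈-refl
  sumOver-concatMap e (u ∷ xs) f =
    ≈-trans (sumOver-++ (e u) (concatMap e xs) f) (+-congˡ (sumOver-concatMap e xs f))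

  termCoeff : ∀ {n} → Mono n → A × Mono n → A
  termCoeff m0 t = if ⌊ proj₂ t ≈M? m0 ⌋ then proj₁ t else 0#

  termCoeff-cong : ∀ {n} (m0 m : Mono n) {a a' : A} → a ≈ a' →
    termCoeff m0 (a , m) ≈ termCoeff m0 (a' , m)
  termCoeff-cong m0 m a≈a' with ⌊ m ≈M? m0 ⌋
  ... | true  = a≈a'
  ... | false = ≈-refl

  termCoeff-≗ : ∀ {n} (m0 : Mono n) (a : A) {m m' : Mono n} → (∀ p q → m p q ≡ m' p q) →
    termCoeff m0 (a , m) ≡ termCoeff m0 (a , m')
  termCoeff-≗ m0 a {m} {m'} m≗m' = cong (λ t → if t then a else 0#) same-test
    where
    same-test : ⌊ m ≈M? m0 ⌋ ≡ ⌊ m' ≈M? m0 ⌋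
    same-test with m ≈M? m0 | m' ≈M? m0
    ... | yes _     | yes _      = refl
    ... | no _      | no _       = refl
    ... | yes m≈m0  | no m'≉m0   = ⊥-elim (m'≉m0 λ p q p<q → trans (sym (m≗m' p q)) (m≈m0 p q p<q))
    ... | no m≉m0   | yes m'≈m0  = ⊥-elim (m≉m0 λ p q p<q → trans (m≗m' p q) (m'≈m0 p q p<q))

  termCoeff-neg : ∀ {n} (m0 m : Mono n) (a : A) → termCoeff m0 (- a , m) ≈ - termCoeff m0 (a , m)
  termCoeff-neg m0 m a with ⌊ m ≈M? m0 ⌋
  ... | true  = ≈-refl
  ... | false = ≈-sym -0#≈0#

  coeff-∷ : ∀ {n} (t : A × Mono n) (p : P n) (m0 : Mono n) →
    coeff (t ∷ p) m0 ≈ termCoeff m0 t + coeff p m0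
  coeff-∷ (a , m) p m0 with ⌊ m ≈M? m0 ⌋
  ... | true  = ≈-refl
  ... | false = ≈-sym (+-identityˡ _)

  coeff-term : ∀ {n} (t : A × Mono n) (m0 : Mono n) → coeff (t ∷ []) m0 ≈ termCoeff m0 t
  coeff-term t m0 = ≈-trans (coeff-∷ t [] m0) (+-identityʳ _)

  coeff-++ : ∀ {n} (p q : P n) (m0 : Mono n) → coeff (p ++ q) m0 ≈ coeff p m0 + coeff q m0
  coeff-++ []      q m0 = ≈-sym (+-identityˡ _)
  coeff-++ (t ∷ p) q m0 = begin
    coeff (t ∷ p ++ q) m0                       ≈⟨ coeff-∷ t (p ++ q) m0 ⟩
    termCoeff m0 t + coeff (p ++ q) m0          ≈⟨ +-congˡ (coeff-++ p q m0) ⟩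
    termCoeff m0 t + (coeff p m0 + coeff q m0)  ≈⟨ +-assoc _ _ _ ⟨
    (termCoeff m0 t + coeff p m0) + coeff q m0  ≈⟨ +-congʳ (coeff-∷ t p m0) ⟨
    coeff (t ∷ p) m0 + coeff q m0               ∎

  coeff-sumP : ∀ {x} {n} {X : Set x} (φ : X → P n) (xs : List X) (m0 : Mono n) →
    coeff (sumP (map φ xs)) m0 ≈ sumOver xs (λ y → coeff (φ y) m0)
  coeff-sumP φ []       m0 = ≈-refl
  coeff-sumP φ (y ∷ xs) m0 = ≈-trans (coeff-++ (φ y) _ m0) (+-congˡ (coeff-sumP φ xs m0))

  coeff-scale : ∀ {n} (a : A) (m : Mono n) (q : P n) (m0 : Mono n) →
    coeff (((a , m) ∷ []) *P q) m0 ≈ sumOver q (λ t → termCoeff m0 (a * proj₁ t , m ⊗M proj₂ t))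
  coeff-scale a m []             m0 = ≈-refl
  coeff-scale a m ((b , m') ∷ q) m0 =
    ≈-trans (coeff-∷ (a * b , m ⊗M m') (((a , m) ∷ []) *P q) m0)
            (+-congˡ (coeff-scale a m q m0))

  matchingCoeff : ∀ {n} → List (Fin n × Fin n) → A
  matchingCoeff []      = 1#
  matchingCoeff (_ ∷ M) = 1# * matchingCoeff M

  matchingCoeff≈1 : ∀ {n} (M : List (Fin n × Fin n)) → matchingCoeff M ≈ 1#
  matchingCoeff≈1 []      = ≈-refl
  matchingCoeff≈1 (_ ∷ M) = ≈-trans (*-identityˡ _) (matchingCoeff≈1 M)

  xM-term : ∀ {n} (M : List (Fin n × Fin n)) → xM M ≡ (matchingCoeff M , matchingMono M) ∷ []
  xM-term []            = refl
  xM-term ((p , q) ∷ M) = cong (x p q *P_) (xM-term M)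

module Degrees {c ℓ} (R : CommutativeRing c ℓ) where
  open Poly R
  open CommutativeRing R using () renaming (Carrier to A; refl to ≈-refl)

  TermsDeg≤ : ∀ {n} → ℕ → P n → Set c
  TermsDeg≤ D p = All (λ t → totalDeg (proj₂ t) ≤ D) p

  -- Only coefficients of monomials of degree > D must vanish, and no listed
  -- term contributes to those.
  termsDeg⇒DegLE : ∀ {n} (D : ℕ) (p : P n) → TermsDeg≤ D p → DegLE D p
  termsDeg⇒DegLE D []             []            m0 D<m0 = ≈-refl
  termsDeg⇒DegLE D ((a , m) ∷ p) (m≤D ∷ p≤D) m0 D<m0 with m ≈M? m0
  ... | yes m≈m0 = ⊥-elim (ℕP.<⇒≱ D<m0 (subst (_≤ D) (deg-≈M m≈m0) m≤D))
  ... | no _     = termsDeg⇒DegLE D p p≤D m0 D<m0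

  termsDeg-weaken : ∀ {n} {D D' : ℕ} (p : P n) → D ≤ D' → TermsDeg≤ D p → TermsDeg≤ D' p
  termsDeg-weaken p D≤D' = All.map (λ m≤D → ℕP.≤-trans m≤D D≤D')

  termsDeg-scale : ∀ {n} {D₁ D₂ : ℕ} (a : A) (m : Mono n) (q : P n) → totalDeg m ≤ D₁ →
    TermsDeg≤ D₂ q → TermsDeg≤ (D₁ ℕ.+ D₂) (((a , m) ∷ []) *P q)
  termsDeg-scale a m []              m≤D₁ []            = []
  termsDeg-scale a m ((b , m') ∷ q) m≤D₁ (m'≤D₂ ∷ q≤D₂) =
    subst (_≤ _) (sym (deg-⊗ m m')) (ℕP.+-mono-≤ m≤D₁ m'≤D₂) ∷ termsDeg-scale a m q m≤D₁ q≤D₂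

  termsDeg-sumAx : ∀ {n} (v : Fin n) → TermsDeg≤ 1 (genP (sumAx v))
  termsDeg-sumAx {n} v =
    ++⁺ (variables (filter (λ u → ¬? (u ≟ v)) (allFin n)))
        (subst (_≤ 1) (sym (deg-oneM {n})) z≤n ∷ [])
    where
    variables : ∀ us → TermsDeg≤ 1 (sumP (map (λ u → x u v) us))
    variables []       = []
    variables (u ∷ us) = deg-singleM u v ∷ variables us

  termsDeg-product : ∀ {n} (u v u' v' : Fin n) → TermsDeg≤ 2 (x u v *P x u' v')
  termsDeg-product u v u' v' =
    subst (_≤ 2) (sym (deg-⊗ (singleM u v) (singleM u' v')))
      (ℕP.+-mono-≤ (deg-singleM u v) (deg-singleM u' v')) ∷ []

module Certificate {c ℓ} (R : CommutativeRing c ℓ) {n : ℕ} (M : List (Fin n × Fin n))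
    (uniq : Unique (endpoints M)) (a : Fin n) (a∉M : a ∉ endpoints M) where
  open Poly R
  open MatchPoly R
  open Coefficients R
  open Degrees R
  open CommutativeRing R
    using (_≈_; _+_; _*_; -_; 0#; 1#; setoid; +-cong; +-congˡ; +-congʳ;
           +-identityʳ; *-identityʳ; *-comm; *-congˡ; -‿cong; -‿inverseʳ; ring)
    renaming (Carrier to A; reflexive to ≈-reflexive; sym to ≈-sym; trans to ≈-trans)
  open import Algebra.Properties.Ring ring using (-‿distribʳ-*)

  partner≢a : ∀ {u} (u∈M : u ∈ endpoints M) → partner M u∈M ≢ a
  partner≢a u∈M w≡a = a∉M (subst (_∈ endpoints M) w≡a (partner-∈ M u∈M))

  correction : ∀ u → u ∈ endpoints M → u ≢ a → P n × Gen n
  correction u u∈M u≢a =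
    -P xM (remainder M u∈M) ,
    prodAx u (partner M u∈M) a (partner-≢ M u∈M uniq) u≢a (partner≢a u∈M)

  corrections : Fin n → List (P n × Gen n)
  corrections u with u ∈? endpoints M | u ≟ a
  ... | yes u∈M | no u≢a = correction u u∈M u≢a ∷ []
  ... | yes _   | yes _  = []
  ... | no _    | _      = []

  certificate : List (P n × Gen n)
  certificate = (xM M , sumAx a) ∷ concatMap corrections (allFin n)

  D : ℕ
  D = suc (length M)

  deg-sumAxMultiple : DegLE D (xM M *P genP (sumAx a))
  deg-sumAxMultiple rewrite xM-term M =
    termsDeg⇒DegLE D _ (termsDeg-weaken _ (ℕP.≤-reflexive (ℕP.+-comm (length M) 1))
      (termsDeg-scale (matchingCoeff M) (matchingMono M) (genP (sumAx a))
        (deg-matchingMono M) (termsDeg-sumAx a)))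

  deg-correction : ∀ u (u∈M : u ∈ endpoints M) (u≢a : u ≢ a) →
    DegLE D (proj₁ (correction u u∈M u≢a) *P genP (proj₂ (correction u u∈M u≢a)))
  deg-correction u u∈M u≢a rewrite xM-term (remainder M u∈M) =
    termsDeg⇒DegLE D _ (termsDeg-weaken _ |M'|+2≤D
      (termsDeg-scale (- matchingCoeff M') (matchingMono M') (x u w *P x u a)
        (deg-matchingMono M') (termsDeg-product u w u a)))
    where
    w  = partner M u∈M
    M' = remainder M u∈M
    |M'|+2≤D : length M' ℕ.+ 2 ≤ D
    |M'|+2≤D = ℕP.≤-reflexive
      (trans (ℕP.+-comm (length M') 2) (cong suc (sym (remainder-length M u∈M))))

  deg-corrections : ∀ u → All (λ t → DegLE D (proj₁ t *P genP (proj₂ t))) (corrections u)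
  deg-corrections u with u ∈? endpoints M | u ≟ a
  ... | yes u∈M | no u≢a = deg-correction u u∈M u≢a ∷ []
  ... | yes _   | yes _  = []
  ... | no _    | _      = []

  -- Stated for any predicate Q that agrees with the degree condition on
  -- pairs, so that it applies to the pattern-matching lambda of `Derivable`.
  certificate-degrees : (Q : P n × Gen n → Set ℓ) →
    (∀ q g → DegLE D (q *P genP g) → Q (q , g)) → All Q certificate
  certificate-degrees Q toQ =
    toQ _ _ deg-sumAxMultiple ∷
    concat⁺ (map⁺ {xs = allFin n} (All.tabulate λ {u} _ →
      All.map (λ {t} → toQ (proj₁ t) (proj₂ t)) (deg-corrections u)))

  module _ (m0 : Mono n) where
    open import Relation.Binary.Reasoning.Setoid setoid

    extended : Fin n → P n
    extended u = xM ((a , u) ∷ M)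

    edgeTerm : Fin n → A
    edgeTerm u = termCoeff m0 (matchingCoeff M * 1# , matchingMono M ⊗M singleM u a)

    constantTerm : A
    constantTerm = termCoeff m0 (matchingCoeff M * - 1# , matchingMono M ⊗M oneM)

    sumAxMultiple-coeff :
      coeff (xM M *P genP (sumAx a)) m0 ≈
      sumOver (allFin n) (λ u → if does (¬? (u ≟ a)) then edgeTerm u else 0#) + constantTerm
    sumAxMultiple-coeff = begin
      coeff (xM M *P genP (sumAx a)) m0
        ≡⟨ cong (λ p → coeff (p *P genP (sumAx a)) m0) (xM-term M) ⟩
      coeff (((matchingCoeff M , matchingMono M) ∷ []) *P genP (sumAx a)) m0
        ≈⟨ coeff-scale (matchingCoeff M) (matchingMono M) (genP (sumAx a)) m0 ⟩
      sumOver (genP (sumAx a)) shifted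
        ≈⟨ sumOver-++ (sumP (map (λ u → x u a) others)) _ shifted ⟩
      sumOver (sumP (map (λ u → x u a) others)) shifted + (constantTerm + 0#)
        ≡⟨ cong (_+ (constantTerm + 0#)) (variables others) ⟩
      sumOver others edgeTerm + (constantTerm + 0#)
        ≈⟨ +-cong (sumOver-filter (λ u → ¬? (u ≟ a)) (allFin n) edgeTerm) (+-identityʳ _) ⟩
      sumOver (allFin n) (λ u → if does (¬? (u ≟ a)) then edgeTerm u else 0#) + constantTerm ∎
      where
      shifted : A × Mono n → A
      shifted t = termCoeff m0 (matchingCoeff M * proj₁ t , matchingMono M ⊗M proj₂ t)
      others : List (Fin n)
      others = filter (λ u → ¬? (u ≟ a)) (allFin n)
      variables : ∀ us → sumOver (sumP (map (λ u → x u a) us)) shifted ≡ sumOver us edgeTerm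
      variables []       = refl
      variables (u ∷ us) = cong (edgeTerm u +_) (variables us)

    constantTerm-cancels : coeff (xM M) m0 + constantTerm ≈ 0#
    constantTerm-cancels = begin
      coeff (xM M) m0 + constantTerm
        ≡⟨ cong (λ p → coeff p m0 + constantTerm) (xM-term M) ⟩
      coeff ((cM , mM) ∷ []) m0 + constantTerm
        ≈⟨ +-cong (coeff-term (cM , mM) m0)
                  (termCoeff-cong m0 (mM ⊗M oneM) (≈-sym (-‿distribʳ-* cM 1#))) ⟩
      termCoeff m0 (cM , mM) + termCoeff m0 (- (cM * 1#) , mM ⊗M oneM)
        ≡⟨ cong (termCoeff m0 (cM , mM) +_) (termCoeff-≗ m0 _ λ p q → ℕP.+-identityʳ (mM p q)) ⟩
      termCoeff m0 (cM , mM) + termCoeff m0 (- (cM * 1#) , mM)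
        ≈⟨ +-congˡ (termCoeff-cong m0 mM (-‿cong (*-identityʳ cM))) ⟩
      termCoeff m0 (cM , mM) + termCoeff m0 (- cM , mM)
        ≈⟨ +-congˡ (termCoeff-neg m0 mM cM) ⟩
      termCoeff m0 (cM , mM) + - termCoeff m0 (cM , mM)
        ≈⟨ -‿inverseʳ _ ⟩
      0# ∎
      where
      cM = matchingCoeff M
      mM = matchingMono M

    extended-coeff : ∀ u → coeff (extended u) m0 ≈ edgeTerm u
    extended-coeff u = begin
      coeff (x a u *P xM M) m0
        ≡⟨ cong (λ p → coeff (x a u *P p) m0) (xM-term M) ⟩
      coeff ((1# * cM , singleM a u ⊗M mM) ∷ []) m0
        ≈⟨ coeff-term (1# * cM , singleM a u ⊗M mM) m0 ⟩
      termCoeff m0 (1# * cM , singleM a u ⊗M mM)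
        ≈⟨ termCoeff-cong m0 (singleM a u ⊗M mM) (*-comm 1# cM) ⟩
      termCoeff m0 (cM * 1# , singleM a u ⊗M mM)
        ≡⟨ termCoeff-≗ m0 (cM * 1#) swap ⟩
      edgeTerm u ∎
      where
      cM = matchingCoeff M
      mM = matchingMono M
      swap : ∀ p q → singleM a u p q ℕ.+ mM p q ≡ mM p q ℕ.+ singleM u a p q
      swap p q = trans (ℕP.+-comm (singleM a u p q) (mM p q))
                       (cong (mM p q ℕ.+_) (singleM-sym a u p q))

    correction-coeff : ∀ u (u∈M : u ∈ endpoints M) (u≢a : u ≢ a) →
      coeff (proj₁ (correction u u∈M u≢a) *P genP (proj₂ (correction u u∈M u≢a))) m0 ≈ - edgeTerm u
    correction-coeff u u∈M u≢a = begin
      coeff ((-P xM M') *P (x u w *P x u a)) m0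
        ≡⟨ cong (λ p → coeff ((-P p) *P (x u w *P x u a)) m0) (xM-term M') ⟩
      coeff ((- cM' * (1# * 1#) , mM' ⊗M (singleM u w ⊗M singleM u a)) ∷ []) m0
        ≈⟨ coeff-term _ m0 ⟩
      termCoeff m0 (- cM' * (1# * 1#) , mM' ⊗M (singleM u w ⊗M singleM u a))
        ≡⟨ termCoeff-≗ m0 _ (matchingMono-reassemble M u∈M (singleM u a)) ⟩
      termCoeff m0 (- cM' * (1# * 1#) , matchingMono M ⊗M singleM u a)
        ≈⟨ termCoeff-cong m0 _ coefficient ⟩
      termCoeff m0 (- (matchingCoeff M * 1#) , matchingMono M ⊗M singleM u a)
        ≈⟨ termCoeff-neg m0 _ _ ⟩
      - edgeTerm u ∎
      where
      w   = partner M u∈M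
      M'  = remainder M u∈M
      cM' = matchingCoeff M'
      mM' = matchingMono M'
      coefficient : - cM' * (1# * 1#) ≈ - (matchingCoeff M * 1#)
      coefficient = begin
        - cM' * (1# * 1#)       ≈⟨ ≈-trans (*-congˡ (*-identityʳ 1#)) (*-identityʳ _) ⟩
        - cM'                   ≈⟨ -‿cong (≈-trans (matchingCoeff≈1 M') (≈-sym (matchingCoeff≈1 M))) ⟩
        - matchingCoeff M       ≈⟨ -‿cong (*-identityʳ _) ⟨
        - (matchingCoeff M * 1#) ∎

    -- The certificate is stated for any φ that agrees with (q , g) ↦ q · g,
    -- again so that it applies to the pattern-matching lambda of `Derivable`.
    module _ (φ : P n × Gen n → P n) (φ-spec : ∀ q g → φ (q , g) ≡ q *P genP g) where

      -- Vertex by vertex, the sum axiom and the corrections leave exactly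
      -- the terms x_M x_{ua} with u free.
      vertex-balance : ∀ u →
        (if does (¬? (u ≟ a)) then edgeTerm u else 0#) + sumOver (corrections u) (λ t → coeff (φ t) m0)
        ≈ (if does (¬? (u ∈? endpoints M) ×-dec ¬? (u ≟ a)) then coeff (extended u) m0 else 0#)
      vertex-balance u with u ∈? endpoints M | u ≟ a
      ... | yes u∈M | no u≢a = begin
        edgeTerm u + (coeff (φ (correction u u∈M u≢a)) m0 + 0#)
          ≈⟨ +-congˡ (+-identityʳ _) ⟩
        edgeTerm u + coeff (φ (correction u u∈M u≢a)) m0
          ≡⟨ cong (λ p → edgeTerm u + coeff p m0) (φ-spec _ _) ⟩
        edgeTerm u + coeff (proj₁ (correction u u∈M u≢a) *P genP (proj₂ (correction u u∈M u≢a))) m0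
          ≈⟨ +-congˡ (correction-coeff u u∈M u≢a) ⟩
        edgeTerm u + - edgeTerm u
          ≈⟨ -‿inverseʳ _ ⟩
        0# ∎
      ... | yes _ | yes _ = +-identityʳ 0#
      ... | no _  | yes _ = +-identityʳ 0#
      ... | no _  | no _  = ≈-trans (+-identityʳ _) (≈-sym (extended-coeff u))

      certificate-value :
        coeff (xM M +P sumP (map φ certificate)) m0 ≈ coeff (sumP (map extended (freeOthers M a))) m0
      certificate-value = begin
        coeff (xM M +P sumP (map φ certificate)) m0
          ≈⟨ coeff-++ (xM M) _ m0 ⟩
        coeff (xM M) m0 + coeff (sumP (map φ certificate)) m0
          ≈⟨ +-congˡ (coeff-sumP φ certificate m0) ⟩
        coeff (xM M) m0 + (κ (xM M , sumAx a) + sumOver (concatMap corrections (allFin n)) κ)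
          ≈⟨ +-congˡ (+-cong (≈-reflexive (cong (λ p → coeff p m0) (φ-spec _ _)))
                              (sumOver-concatMap corrections (allFin n) κ)) ⟩
        coeff (xM M) m0 + (coeff (xM M *P genP (sumAx a)) m0 + sumOver (allFin n) correctionSum)
          ≈⟨ +-congˡ (+-congʳ sumAxMultiple-coeff) ⟩
        coeff (xM M) m0 + ((sumOver (allFin n) sumAxTerm + constantTerm) + sumOver (allFin n) correctionSum)
          ≈⟨ cancel-inside constantTerm-cancels ⟩
        sumOver (allFin n) sumAxTerm + sumOver (allFin n) correctionSum
          ≈⟨ sumOver-+ (allFin n) sumAxTerm correctionSum ⟨
        sumOver (allFin n) (λ u → sumAxTerm u + correctionSum u)
          ≈⟨ sumOver-cong (allFin n) vertex-balance ⟩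
        sumOver (allFin n) (λ u → if does (¬? (u ∈? endpoints M) ×-dec ¬? (u ≟ a)) then κ′ u else 0#)
          ≈⟨ sumOver-filter (λ u → ¬? (u ∈? endpoints M) ×-dec ¬? (u ≟ a)) (allFin n) κ′ ⟨
        sumOver (freeOthers M a) κ′
          ≈⟨ coeff-sumP extended (freeOthers M a) m0 ⟨
        coeff (sumP (map extended (freeOthers M a))) m0 ∎
        where
        κ : P n × Gen n → A
        κ t = coeff (φ t) m0
        κ′ : Fin n → A
        κ′ u = coeff (extended u) m0
        sumAxTerm correctionSum : Fin n → A
        sumAxTerm u = if does (¬? (u ≟ a)) then edgeTerm u else 0#
        correctionSum u = sumOver (corrections u) κ
mainTheorem8 : ∀ {c ℓ} (R : CommutativeRing c ℓ) (n : ℕ) → 0 < n → 2 ∣ n →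
    (d : ℕ) (M : List (Fin n × Fin n)) → Unique (endpoints M) → length M ≡ d →
    (a : Fin n) → a ∉ endpoints M →
    Poly.Derivable R n (suc d) (MatchPoly.xM R M)
      (Poly.sumP R (map (λ u → MatchPoly.xM R ((a , u) ∷ M)) (freeOthers M a)))
mainTheorem8 R n _ _ .(length M) M uniq refl a a∉M =
  certificate ,
  certificate-degrees _ (λ q g deg → deg) ,
  λ m0 → certificate-value m0 _ (λ q g → refl)
  where open Certificate R M uniq a a∉M
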